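{- Let $\mathbf{D}$ be a dagger kernel category and $X$ an object. The map $m\mapsto[\![m]\!]:=m\circ m^\dagger$ gives order isomorphisms $\mathrm{KSub}(X)\cong\{p\colon X\to X\mid p^\dagger=p\le\mathrm{id}\}\cong\{p\colon X\to X\mid p^\dagger=p\circ p=p\le\mathrm{id}\}$, and, if every zero-epi in $\mathbf{D}$ is an epimorphism, moreover $\{p\colon X\to X\mid p^\dagger=p\circ p=p\le\mathrm{id}\}=\{p\colon X\to X\mid p^\dagger=p\circ p=p\}$, so that $\mathrm{KSub}(X)$ is order isomorphic to the set of self-adjoint idempotents on $X$.
   Context: A dagger category is a category with a contravariant functor $\dagger$ that is the identity on objects with $f^{\dagger\dagger}=f$; $f$ is a dagger mono if $f^\dagger\circ f=\mathrm{id}$. A dagger kernel category is a dagger category with a zero object $0$ in which every morphism $f$ has a kernel (universal $k$ with $f\circ k=0$) that can be chosen to be a dagger mono, denoted $\ker(f)$; kernels are represented by dagger monos. $\mathrm{coker}(f)=\ker(f^\dagger)^\dagger$. $\mathrm{KSub}(X)$ is the poset of kernels with codomain $X$ modulo isomorphism of domains, with $m\le n$ iff $m=n\circ\varphi$. A zero-epi is a morphism $e$ such that $h\circ e=0$ implies $h=0$. The order on homsets: for $f\colon X\to Y$ let $i_f=\ker(\mathrm{coker}(f))\colon\mathrm{Im}(f)\to Y$, $e_f=(i_f)^\dagger\circ f$, and let $m_f\colon\mathrm{Im}(f^\dagger)\to\mathrm{Im}(f)$ be the unique morphism with $m_f\circ(i_{f^\dagger})^\dagger=e_f$ and $i_f\circ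 m_f=(e_{f^\dagger})^\dagger$. For parallel $f,g$, $f\le g$ iff there exist $\varphi\colon\mathrm{Im}(f)\to\mathrm{Im}(g)$ and $\psi\colon\mathrm{Im}(f^\dagger)\to\mathrm{Im}(g^\dagger)$ with $\psi^\dagger\circ(i_{g^\dagger})^\dagger=(i_{f^\dagger})^\dagger$, $\varphi\circ m_f=m_g\circ\psi$, $\varphi^\dagger\circ m_g=m_f\circ\psi^\dagger$, and $i_g\circ\varphi=i_f$. The sets of endomorphisms above are ordered by this relation. -}

module Defs where

open import Level using (Level; _⊔_; suc)
open import Data.Product using (Σ; Σ-syntax; ∃; ∃-syntax; _×_; _,_)
open import Relation.Binary using (Rel; IsEquivalence)

record DaggerKernelCategory (o ℓ e : Level) : Set (suc (o ⊔ ℓ ⊔ e)) where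
  infix  4 _≈_
  infixr 9 _∘_
  infix  10 _†
  field
    Obj   : Set o
    _⇒_   : Obj → Obj → Set ℓ
    _≈_   : ∀ {A B} → Rel (A ⇒ B) e
    ≈-equiv : ∀ {A B} → IsEquivalence (_≈_ {A} {B})
    id    : ∀ {A} → A ⇒ A
    _∘_   : ∀ {A B C} → B ⇒ C → A ⇒ B → A ⇒ C
    assoc : ∀ {A B C D} {f : A ⇒ B} {g : B ⇒ C} {h : C ⇒ D} →
            (h ∘ g) ∘ f ≈ h ∘ (g ∘ f)
    identityˡ : ∀ {A B} {f : A ⇒ B} → id ∘ f ≈ f
    identityʳ : ∀ {A B} {f : A ⇒ B} → f ∘ id ≈ f
    ∘-resp-≈  : ∀ {A B C} {f h : B ⇒ C} {g i : A ⇒ B} →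
                f ≈ h → g ≈ i → f ∘ g ≈ h ∘ i
    _†        : ∀ {A B} → A ⇒ B → B ⇒ A
    †-resp-≈  : ∀ {A B} {f g : A ⇒ B} → f ≈ g → f † ≈ g †
    †-identity : ∀ {A} → id {A} † ≈ id
    †-homomorphism : ∀ {A B C} {f : A ⇒ B} {g : B ⇒ C} → (g ∘ f) † ≈ f † ∘ g †
    †-involutive : ∀ {A B} {f : A ⇒ B} → f † † ≈ f
    𝟎       : Obj
    ¡       : ∀ {A} → 𝟎 ⇒ A
    ¡-unique : ∀ {A} (f : 𝟎 ⇒ A) → f ≈ ¡
    !       : ∀ {A} → A ⇒ 𝟎
    !-unique : ∀ {A} (f : A ⇒ 𝟎) → f ≈ !

  zero : ∀ {A B} → A ⇒ B
  zero = ¡ ∘ !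

  IsDaggerMono : ∀ {A B} → A ⇒ B → Set e
  IsDaggerMono f = f † ∘ f ≈ id

  IsKernel : ∀ {X Y K} → X ⇒ Y → K ⇒ X → Set (o ⊔ ℓ ⊔ e)
  IsKernel {X} {Y} {K} f k =
    (f ∘ k ≈ zero) ×
    (∀ {Z} (g : Z ⇒ X) → f ∘ g ≈ zero →
       Σ[ h ∈ Z ⇒ K ] ((k ∘ h ≈ g) × (∀ (h′ : Z ⇒ K) → k ∘ h′ ≈ g → h′ ≈ h)))

  field
    Ker        : ∀ {X Y} → X ⇒ Y → Obj
    ker        : ∀ {X Y} (f : X ⇒ Y) → Ker f ⇒ X
    ker-isKernel : ∀ {X Y} (f : X ⇒ Y) → IsKernel f (ker f)
    ker-dagger-mono : ∀ {X Y} (f : X ⇒ Y) → IsDaggerMono (ker f)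

  coker : ∀ {X Y} (f : X ⇒ Y) → Y ⇒ Ker (f †)
  coker f = ker (f †) †

  Im : ∀ {X Y} → X ⇒ Y → Obj
  Im f = Ker (coker f)

  i : ∀ {X Y} (f : X ⇒ Y) → Im f ⇒ Y
  i f = ker (coker f)

  e′ : ∀ {X Y} (f : X ⇒ Y) → X ⇒ Im f
  e′ f = i f † ∘ f

  -- m is "the" morphism m_f : Im(f†) → Im(f) (it is unique when it exists)
  IsM : ∀ {X Y} (f : X ⇒ Y) → Im (f †) ⇒ Im f → Set e
  IsM f m = (m ∘ i (f †) † ≈ e′ f) × (i f ∘ m ≈ e′ (f †) †)

  _≤h_ : ∀ {X Y} → X ⇒ Y → X ⇒ Y → Set (ℓ ⊔ e)
  f ≤h g =
    Σ[ mf ∈ Im (f †) ⇒ Im f ] Σ[ mg ∈ Im (g †) ⇒ Im g ]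
      (IsM f mf × IsM g mg ×
       Σ[ φ ∈ Im f ⇒ Im g ] Σ[ ψ ∈ Im (f †) ⇒ Im (g †) ]
         ((ψ † ∘ i (g †) † ≈ i (f †) †) ×
          (φ ∘ mf ≈ mg ∘ ψ) ×
          (φ † ∘ mg ≈ mf ∘ ψ †) ×
          (i g ∘ φ ≈ i f)))

  IsZeroEpi : ∀ {A B} → A ⇒ B → Set (o ⊔ ℓ ⊔ e)
  IsZeroEpi {A} {B} f = ∀ {C} (h : B ⇒ C) → h ∘ f ≈ zero → h ≈ zero

  IsEpi : ∀ {A B} → A ⇒ B → Set (o ⊔ ℓ ⊔ e)
  IsEpi {A} {B} f = ∀ {C} (h k : B ⇒ C) → h ∘ f ≈ k ∘ f → h ≈ k

  -- elements of KSub(X): kernels with codomain X, represented by dagger monos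
  record KSubObj (X : Obj) : Set (o ⊔ ℓ ⊔ e) where
    field
      dom  : Obj
      arr  : dom ⇒ X
      arr-dagger-mono : IsDaggerMono arr
      arr-isKernel : Σ[ Y ∈ Obj ] Σ[ f ∈ X ⇒ Y ] IsKernel f arr

  open KSubObj public

  _≤K_ : ∀ {X} → KSubObj X → KSubObj X → Set (ℓ ⊔ e)
  m ≤K n = Σ[ φ ∈ dom m ⇒ dom n ] (arr m ≈ arr n ∘ φ)

  ⟦_⟧ : ∀ {X} → KSubObj X → X ⇒ X
  ⟦ m ⟧ = arr m ∘ arr m †

  -- ⟦_⟧ is an order isomorphism from KSub(X) (the poset reflection of ≤K)
  -- onto the subset {p | P p} of X ⇒ X (taken up to ≈, ordered by ≤h).
  record IsOrderIsoOnto {X : Obj} (P : X ⇒ X → Set (ℓ ⊔ e)) : Set (o ⊔ ℓ ⊔ e) where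
    field
      lands-in     : ∀ (m : KSubObj X) → P ⟦ m ⟧
      well-defined : ∀ (m n : KSubObj X) → m ≤K n → n ≤K m → ⟦ m ⟧ ≈ ⟦ n ⟧
      injective    : ∀ (m n : KSubObj X) → ⟦ m ⟧ ≈ ⟦ n ⟧ → (m ≤K n) × (n ≤K m)
      monotone     : ∀ (m n : KSubObj X) → m ≤K n → ⟦ m ⟧ ≤h ⟦ n ⟧
      reflecting   : ∀ (m n : KSubObj X) → ⟦ m ⟧ ≤h ⟦ n ⟧ → m ≤K n
      surjective   : ∀ (p : X ⇒ X) → P p → Σ[ m ∈ KSubObj X ] (⟦ m ⟧ ≈ p)

  SelfAdjBelowId : ∀ {X} → X ⇒ X → Set (ℓ ⊔ e)
  SelfAdjBelowId p = (p † ≈ p) × (p ≤h id)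

  ProjBelowId : ∀ {X} → X ⇒ X → Set (ℓ ⊔ e)
  ProjBelowId p = (p † ≈ p) × (p ∘ p ≈ p) × (p ≤h id)

  Proj : ∀ {X} → X ⇒ X → Set (ℓ ⊔ e)
  Proj {X} p = Level.Lift (ℓ ⊔ e) ((p † ≈ p) × (p ∘ p ≈ p))

module Submission where

-- Structure of the argument.
--  * Elementary dagger/zero algebra, and the basic fact that a dagger-mono
--    kernel k of f satisfies k ∘ k† ∘ g ≈ g whenever f ∘ g ≈ zero.
--  * Images: f factors as i f ∘ e′ f, anything killing f kills i f, and e′ f
--    is a zero-epi.
--  * If p ≈ ⟦ m ⟧ then the comparison map u = i p † ∘ m is a dagger mono with
--    i p ∘ u ≈ m and m ∘ u † ≈ i p, so the image data of p (i p, i (p †),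
--    m_p) is m itself up to comparisons.  From this, m ≤ n gives
--    ⟦ m ⟧ ≤h ⟦ n ⟧ (conjugating the
--    factorisation of m through n), and conversely the image-part of a witness
--    of ⟦ m ⟧ ≤h ⟦ n ⟧ gives m ≤ n.
--  * p ≤h id forces p ≈ ⟦ i (p †) ⟧ (surjectivity), and a self-adjoint
--    idempotent p with e′ p epic equals ⟦ i p ⟧, hence lies below id.

open import Defs
open import Level using (Level; _⊔_; lift)
open import Data.Product using (_×_; _,_; proj₁; proj₂)
open import Function.Base using (_∘′_)
open import Function.Bundles using (_⇔_; mk⇔)
open import Relation.Binary using (Setoid; IsEquivalence)
import Relation.Binary.Reasoning.Setoid as SetoidReasoning

module Projections {o ℓ e : Level} (D : DaggerKernelCategory o ℓ e) where
  open DaggerKernelCategory D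

  homSetoid : Obj → Obj → Setoid ℓ e
  homSetoid A B = record { Carrier = A ⇒ B ; _≈_ = _≈_ ; isEquivalence = ≈-equiv }

  module HomReasoning {A B : Obj} = SetoidReasoning (homSetoid A B)
  open HomReasoning

  ≈-refl : ∀ {A B} {f : A ⇒ B} → f ≈ f
  ≈-refl = IsEquivalence.refl ≈-equiv

  ≈-sym : ∀ {A B} {f g : A ⇒ B} → f ≈ g → g ≈ f
  ≈-sym = IsEquivalence.sym ≈-equiv

  ≈-trans : ∀ {A B} {f g h : A ⇒ B} → f ≈ g → g ≈ h → f ≈ h
  ≈-trans = IsEquivalence.trans ≈-equiv

  ∘-congˡ : ∀ {A B C} {h : A ⇒ B} {f g : B ⇒ C} → f ≈ g → f ∘ h ≈ g ∘ h
  ∘-congˡ f≈g = ∘-resp-≈ f≈g ≈-refl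

  ∘-congʳ : ∀ {A B C} {h : B ⇒ C} {f g : A ⇒ B} → f ≈ g → h ∘ f ≈ h ∘ g
  ∘-congʳ f≈g = ∘-resp-≈ ≈-refl f≈g

  assoc˘ : ∀ {A B C D} {f : A ⇒ B} {g : B ⇒ C} {h : C ⇒ D} →
           h ∘ (g ∘ f) ≈ (h ∘ g) ∘ f
  assoc˘ = ≈-sym assoc

  zero-absorbˡ : ∀ {A B C} {f : A ⇒ B} → zero {B} {C} ∘ f ≈ zero
  zero-absorbˡ = ≈-trans assoc (∘-congʳ (!-unique _))

  zero-absorbʳ : ∀ {A B C} {f : B ⇒ C} → f ∘ zero {A} {B} ≈ zero
  zero-absorbʳ = ≈-trans assoc˘ (∘-congˡ (¡-unique _))

  zero-† : ∀ {A B} → zero {A} {B} † ≈ zero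
  zero-† = ≈-trans †-homomorphism (∘-resp-≈ (¡-unique _) (!-unique _))

  zero-dual : ∀ {A B C} {f : B ⇒ C} {g : A ⇒ B} → f ∘ g ≈ zero → g † ∘ f † ≈ zero
  zero-dual fg≈0 = ≈-trans (≈-sym †-homomorphism) (≈-trans (†-resp-≈ fg≈0) zero-†)

  †-swapʳ : ∀ {A B C} {f : B ⇒ C} {g : B ⇒ A} → (f ∘ g †) † ≈ g ∘ f †
  †-swapʳ = ≈-trans †-homomorphism (∘-congˡ †-involutive)

  †-swapˡ : ∀ {A B C} {f : C ⇒ B} {g : A ⇒ B} → (f † ∘ g) † ≈ g † ∘ f
  †-swapˡ = ≈-trans †-homomorphism (∘-congʳ †-involutive)

  †-sandwich : ∀ {A B C D} {a : C ⇒ D} {b : B ⇒ C} {c : B ⇒ A} →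
               (a ∘ (b ∘ c †)) † ≈ c ∘ (b † ∘ a †)
  †-sandwich = ≈-trans (≈-trans †-homomorphism (∘-congˡ †-swapʳ)) assoc

  projection-selfAdjoint : ∀ {A B} (f : A ⇒ B) → (f ∘ f †) † ≈ f ∘ f †
  projection-selfAdjoint f = †-swapʳ

  ⟦⟧-selfAdjoint : ∀ {X} (m : KSubObj X) → ⟦ m ⟧ † ≈ ⟦ m ⟧
  ⟦⟧-selfAdjoint m = projection-selfAdjoint (arr m)

  cancel-dagger-mono : ∀ {A B C} {k : A ⇒ B} {x : C ⇒ A} →
                       IsDaggerMono k → k † ∘ (k ∘ x) ≈ x
  cancel-dagger-mono k†k≈id = ≈-trans assoc˘ (≈-trans (∘-congˡ k†k≈id) identityˡ)

  dagger-mono-factor : ∀ {A B C} {u : A ⇒ C} {v : B ⇒ C} {x : A ⇒ B} →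
                       u ≈ v ∘ x → IsDaggerMono v → IsDaggerMono u → IsDaggerMono x
  dagger-mono-factor {u = u} {v} {x} u≈vx v-dm u-dm = begin
    x † ∘ x                ≈⟨ ∘-congʳ (cancel-dagger-mono v-dm) ⟨
    x † ∘ (v † ∘ (v ∘ x))  ≈⟨ assoc˘ ⟩
    (x † ∘ v †) ∘ (v ∘ x)  ≈⟨ ∘-congˡ †-homomorphism ⟨
    (v ∘ x) † ∘ (v ∘ x)    ≈⟨ ∘-resp-≈ (†-resp-≈ u≈vx) u≈vx ⟨
    u † ∘ u                ≈⟨ u-dm ⟩
    id                     ∎

  projection-fixes : ∀ {A B} {m : A ⇒ B} → IsDaggerMono m → (m ∘ m †) ∘ m ≈ m
  projection-fixes m-dm = ≈-trans assoc (≈-trans (∘-congʳ m-dm) identityʳ)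

  -- A dagger-mono kernel k of f satisfies k ∘ k † ∘ g ≈ g for every g killed
  -- by f: the factorisation of g through k is k † ∘ g.
  kernel-retract : ∀ {X Y K Z} {f : X ⇒ Y} {k : K ⇒ X} → IsKernel f k →
                   IsDaggerMono k → {g : Z ⇒ X} → f ∘ g ≈ zero → k ∘ (k † ∘ g) ≈ g
  kernel-retract {k = k} (_ , universal) k-dm {g} fg≈0 = begin
    k ∘ (k † ∘ g)         ≈⟨ ∘-congʳ (∘-congʳ kh≈g) ⟨
    k ∘ (k † ∘ (k ∘ h))   ≈⟨ ∘-congʳ (cancel-dagger-mono k-dm) ⟩
    k ∘ h                 ≈⟨ kh≈g ⟩
    g                     ∎
    where
      h = proj₁ (universal g fg≈0)
      kh≈g = proj₁ (proj₂ (universal g fg≈0))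

  coker-kills : ∀ {X Y} (f : X ⇒ Y) → coker f ∘ f ≈ zero
  coker-kills f = ≈-trans (∘-congʳ (≈-sym †-involutive))
                          (zero-dual (proj₁ (ker-isKernel (f †))))

  image-factorisation : ∀ {X Y} (f : X ⇒ Y) → i f ∘ e′ f ≈ f
  image-factorisation f =
    kernel-retract (ker-isKernel (coker f)) (ker-dagger-mono (coker f)) (coker-kills f)

  -- Whatever kills f also kills its image: g ∘ f ≈ zero factors g through
  -- coker f, which kills i f.
  image-killed : ∀ {X Y Z} (f : X ⇒ Y) {g : Y ⇒ Z} → g ∘ f ≈ zero → g ∘ i f ≈ zero
  image-killed f {g} gf≈0 = begin
    g ∘ i f                  ≈⟨ ∘-congˡ †-involutive ⟨
    g † † ∘ i f              ≈⟨ ∘-congˡ (†-resp-≈ kh≈g†) ⟨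
    (ker (f †) ∘ h) † ∘ i f  ≈⟨ ∘-congˡ †-homomorphism ⟩
    (h † ∘ coker f) ∘ i f    ≈⟨ assoc ⟩
    h † ∘ (coker f ∘ i f)    ≈⟨ ∘-congʳ (proj₁ (ker-isKernel (coker f))) ⟩
    h † ∘ zero               ≈⟨ zero-absorbʳ ⟩
    zero                     ∎
    where
      factorisation = proj₂ (ker-isKernel (f †)) (g †) (zero-dual gf≈0)
      h = proj₁ factorisation
      kh≈g† = proj₁ (proj₂ factorisation)

  e′-zeroEpi : ∀ {X Y} (f : X ⇒ Y) → IsZeroEpi (e′ f)
  e′-zeroEpi f h he≈0 = begin
    h                      ≈⟨ identityʳ ⟨
    h ∘ id                 ≈⟨ ∘-congʳ (ker-dagger-mono (coker f)) ⟨
    h ∘ (i f † ∘ i f)      ≈⟨ assoc˘ ⟩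
    (h ∘ i f †) ∘ i f      ≈⟨ image-killed f (≈-trans assoc he≈0) ⟩
    zero                   ∎

  top : ∀ {X} → KSubObj X
  top {X} = record
    { dom = X ; arr = id
    ; arr-dagger-mono = ≈-trans (∘-congˡ †-identity) identityˡ
    ; arr-isKernel = 𝟎 , ! , ≈-trans (!-unique _) (≈-sym (!-unique _)) ,
        λ g _ → g , identityˡ , λ h g≈h → ≈-trans (≈-sym identityˡ) g≈h }

  image : ∀ {X Y} (f : X ⇒ Y) → KSubObj Y
  image f = record
    { dom = Im f ; arr = i f
    ; arr-dagger-mono = ker-dagger-mono (coker f)
    ; arr-isKernel = _ , coker f , ker-isKernel (coker f) }

  ⟦top⟧ : ∀ {X} → id {X} ≈ ⟦ top ⟧
  ⟦top⟧ = ≈-sym (≈-trans (∘-congʳ †-identity) identityˡ)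

  -- Comparison of a kernel m with the image of p ≈ ⟦ m ⟧: the map
  -- i p † ∘ m : dom m → Im p is a dagger mono identifying m with i p.
  comparison : ∀ {X} (p : X ⇒ X) (m : KSubObj X) → dom m ⇒ Im p
  comparison p m = i p † ∘ arr m

  module _ {X : Obj} {p : X ⇒ X} (m : KSubObj X) (p≈⟦m⟧ : p ≈ ⟦ m ⟧) where

    -- m lies below the image of p, since coker p kills p ∘ m ≈ m.
    comparison-left : i p ∘ comparison p m ≈ arr m
    comparison-left = kernel-retract (ker-isKernel (coker p)) (ker-dagger-mono (coker p)) (begin
      coker p ∘ arr m              ≈⟨ ∘-congʳ (projection-fixes (arr-dagger-mono m)) ⟨
      coker p ∘ (⟦ m ⟧ ∘ arr m)    ≈⟨ ∘-congʳ (∘-congˡ p≈⟦m⟧) ⟨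
      coker p ∘ (p ∘ arr m)        ≈⟨ assoc˘ ⟩
      (coker p ∘ p) ∘ arr m        ≈⟨ ∘-congˡ (coker-kills p) ⟩
      zero ∘ arr m                 ≈⟨ zero-absorbˡ ⟩
      zero                         ∎)

    -- The image of p lies below m: if m is the kernel of g, then g kills p,
    -- hence kills i p.
    comparison-right : arr m ∘ comparison p m † ≈ i p
    comparison-right = begin
      arr m ∘ (i p † ∘ arr m) †    ≈⟨ ∘-congʳ †-swapˡ ⟩
      arr m ∘ (arr m † ∘ i p)      ≈⟨ kernel-retract m-kernel (arr-dagger-mono m) (image-killed p g∘p≈0) ⟩
      i p                          ∎
      where
        g = proj₁ (proj₂ (arr-isKernel m))
        m-kernel = proj₂ (proj₂ (arr-isKernel m))
        g∘p≈0 : g ∘ p ≈ zero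
        g∘p≈0 = begin
          g ∘ p                      ≈⟨ ∘-congʳ p≈⟦m⟧ ⟩
          g ∘ (arr m ∘ arr m †)      ≈⟨ assoc˘ ⟩
          (g ∘ arr m) ∘ arr m †      ≈⟨ ∘-congˡ (proj₁ m-kernel) ⟩
          zero ∘ arr m †             ≈⟨ zero-absorbˡ ⟩
          zero                       ∎

    comparison-dagger-mono : IsDaggerMono (comparison p m)
    comparison-dagger-mono =
      dagger-mono-factor (≈-sym comparison-left) (ker-dagger-mono (coker p)) (arr-dagger-mono m)

  ⟦⟧-dual : ∀ {X} {p : X ⇒ X} (m : KSubObj X) → p ≈ ⟦ m ⟧ → p † ≈ ⟦ m ⟧
  ⟦⟧-dual m p≈⟦m⟧ = ≈-trans (†-resp-≈ p≈⟦m⟧) (⟦⟧-selfAdjoint m)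

  mediator : ∀ {X} (p : X ⇒ X) (m : KSubObj X) → Im (p †) ⇒ Im p
  mediator p m = comparison p m ∘ comparison (p †) m †

  mediator-isM : ∀ {X} {p : X ⇒ X} (m : KSubObj X) (p≈⟦m⟧ : p ≈ ⟦ m ⟧) → IsM p (mediator p m)
  mediator-isM {p = p} m p≈⟦m⟧ = through-coimage , through-image
    where
      u = comparison p m
      w = comparison (p †) m
      M = arr m
      w-left : i (p †) ∘ w ≈ M
      w-left = comparison-left m (⟦⟧-dual m p≈⟦m⟧)
      through-coimage : mediator p m ∘ i (p †) † ≈ e′ p
      through-coimage = begin
        (u ∘ w †) ∘ i (p †) †     ≈⟨ assoc ⟩
        u ∘ (w † ∘ i (p †) †)     ≈⟨ ∘-congʳ †-homomorphism ⟨
        u ∘ (i (p †) ∘ w) †       ≈⟨ ∘-congʳ (†-resp-≈ w-left) ⟩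
        u ∘ M †                   ≈⟨ ∘-congʳ (cancel-dagger-mono (arr-dagger-mono m)) ⟨
        u ∘ (M † ∘ (M ∘ M †))     ≈⟨ assoc˘ ⟩
        (u ∘ M †) ∘ (M ∘ M †)     ≈⟨ ∘-resp-≈ †-swapʳ p≈⟦m⟧ ⟨
        (M ∘ u †) † ∘ p           ≈⟨ ∘-congˡ (†-resp-≈ (comparison-right m p≈⟦m⟧)) ⟩
        i p † ∘ p                 ∎
      through-image : i p ∘ mediator p m ≈ e′ (p †) †
      through-image = begin
        i p ∘ (u ∘ w †)           ≈⟨ assoc˘ ⟩
        (i p ∘ u) ∘ w †           ≈⟨ ∘-congˡ (comparison-left m p≈⟦m⟧) ⟩
        M ∘ w †                   ≈⟨ ∘-congʳ (cancel-dagger-mono (arr-dagger-mono m)) ⟨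
        M ∘ (M † ∘ (M ∘ w †))     ≈⟨ assoc˘ ⟩
        (M ∘ M †) ∘ (M ∘ w †)     ≈⟨ ∘-resp-≈ (≈-sym p≈⟦m⟧) (comparison-right m (⟦⟧-dual m p≈⟦m⟧)) ⟩
        p ∘ i (p †)               ≈⟨ ∘-congˡ †-involutive ⟨
        p † † ∘ i (p †)           ≈⟨ †-swapˡ ⟨
        (i (p †) † ∘ p †) †       ∎

  conjugate-factor : ∀ {M N P Q X} {a : Q ⇒ X} {u : N ⇒ Q} {n : N ⇒ X}
                     {m : M ⇒ X} {v : M ⇒ P} {b : P ⇒ X} {φ : M ⇒ N} →
                     a ∘ u ≈ n → m ∘ v † ≈ b → m ≈ n ∘ φ → a ∘ (u ∘ (φ ∘ v †)) ≈ b
  conjugate-factor {a = a} {u} {n} {m} {v} {b} {φ} au≈n mv†≈b m≈nφ = begin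
    a ∘ (u ∘ (φ ∘ v †))   ≈⟨ assoc˘ ⟩
    (a ∘ u) ∘ (φ ∘ v †)   ≈⟨ ∘-congˡ au≈n ⟩
    n ∘ (φ ∘ v †)         ≈⟨ assoc˘ ⟩
    (n ∘ φ) ∘ v †         ≈⟨ ∘-congˡ m≈nφ ⟨
    m ∘ v †               ≈⟨ mv†≈b ⟩
    b                     ∎

  exchange-dagger-monos : ∀ {M N P P′ Q Q′} {a : M ⇒ P} {b : M ⇒ P′} {x : M ⇒ N}
                          {c : N ⇒ Q} {d : N ⇒ Q′} → IsDaggerMono a → IsDaggerMono d →
                          (c ∘ (x ∘ a †)) ∘ (a ∘ b †) ≈ (c ∘ d †) ∘ (d ∘ (x ∘ b †))
  exchange-dagger-monos {a = a} {b} {x} {c} {d} a-dm d-dm = begin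
    (c ∘ (x ∘ a †)) ∘ (a ∘ b †)    ≈⟨ assoc ⟩
    c ∘ ((x ∘ a †) ∘ (a ∘ b †))    ≈⟨ ∘-congʳ assoc ⟩
    c ∘ (x ∘ (a † ∘ (a ∘ b †)))    ≈⟨ ∘-congʳ (∘-congʳ (cancel-dagger-mono a-dm)) ⟩
    c ∘ (x ∘ b †)                  ≈⟨ ∘-congʳ (cancel-dagger-mono d-dm) ⟨
    c ∘ (d † ∘ (d ∘ (x ∘ b †)))    ≈⟨ assoc˘ ⟩
    (c ∘ d †) ∘ (d ∘ (x ∘ b †))    ∎

  -- The
  -- witnesses φ, ψ are the factorisation of m through n conjugated by the
  -- comparisons of m, n with the images of p, q resp. of p †, q †.
  ⟦⟧-monotone-at : ∀ {X} (m n : KSubObj X) → m ≤K n → {p q : X ⇒ X} →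
                   p ≈ ⟦ m ⟧ → q ≈ ⟦ n ⟧ → p ≤h q
  ⟦⟧-monotone-at m n (θ , m≈nθ) {p} {q} p≈⟦m⟧ q≈⟦n⟧ =
      mediator p m , mediator q n , mediator-isM m p≈⟦m⟧ , mediator-isM n q≈⟦n⟧ ,
      φ , ψ , coimage-square , mediator-square , dual-mediator-square , image-square
    where
      p†≈⟦m⟧ = ⟦⟧-dual m p≈⟦m⟧
      q†≈⟦n⟧ = ⟦⟧-dual n q≈⟦n⟧
      uₚ = comparison p m
      wₚ = comparison (p †) m
      u_q = comparison q n
      w_q = comparison (q †) n
      φ = u_q ∘ (θ ∘ uₚ †)
      ψ = w_q ∘ (θ ∘ wₚ †)
      image-square : i q ∘ φ ≈ i p
      image-square =
        conjugate-factor (comparison-left n q≈⟦n⟧) (comparison-right m p≈⟦m⟧) m≈nθ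
      coimage-square : ψ † ∘ i (q †) † ≈ i (p †) †
      coimage-square = ≈-trans (≈-sym †-homomorphism) (†-resp-≈
        (conjugate-factor (comparison-left n q†≈⟦n⟧) (comparison-right m p†≈⟦m⟧) m≈nθ))
      mediator-square : φ ∘ mediator p m ≈ mediator q n ∘ ψ
      mediator-square = exchange-dagger-monos
        (comparison-dagger-mono m p≈⟦m⟧) (comparison-dagger-mono n q†≈⟦n⟧)
      dual-mediator-square : φ † ∘ mediator q n ≈ mediator p m ∘ ψ †
      dual-mediator-square = begin
        φ † ∘ (u_q ∘ w_q †)                     ≈⟨ ∘-congˡ †-sandwich ⟩
        (uₚ ∘ (θ † ∘ u_q †)) ∘ (u_q ∘ w_q †)    ≈⟨ exchange-dagger-monos
            (comparison-dagger-mono n q≈⟦n⟧) (comparison-dagger-mono m p†≈⟦m⟧) ⟩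
        (uₚ ∘ wₚ †) ∘ (wₚ ∘ (θ † ∘ w_q †))      ≈⟨ ∘-congʳ †-sandwich ⟨
        (uₚ ∘ wₚ †) ∘ ψ †                       ∎

  ⟦⟧-monotone : ∀ {X} (m n : KSubObj X) → m ≤K n → ⟦ m ⟧ ≤h ⟦ n ⟧
  ⟦⟧-monotone m n m≤n = ⟦⟧-monotone-at m n m≤n ≈-refl ≈-refl

  ⟦⟧-below-id : ∀ {X} (m : KSubObj X) → ⟦ m ⟧ ≤h id
  ⟦⟧-below-id m = ⟦⟧-monotone-at m top (arr m , ≈-sym identityˡ) ≈-refl ⟦top⟧

  -- Order reflection: the image part i ⟦ n ⟧ ∘ φ ≈ i ⟦ m ⟧ of a witness of
  -- ⟦ m ⟧ ≤h ⟦ n ⟧ already factors m through n, via the comparisons.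
  ⟦⟧-reflecting : ∀ {X} (m n : KSubObj X) → ⟦ m ⟧ ≤h ⟦ n ⟧ → m ≤K n
  ⟦⟧-reflecting m n (_ , _ , _ , _ , φ , _ , _ , _ , _ , image-square) =
      (uₙ † ∘ (φ ∘ uₘ)) , (begin
      arr m                         ≈⟨ comparison-left m ≈-refl ⟨
      i ⟦ m ⟧ ∘ uₘ                  ≈⟨ ∘-congˡ image-square ⟨
      (i ⟦ n ⟧ ∘ φ) ∘ uₘ            ≈⟨ ∘-congˡ (∘-congˡ (comparison-right n ≈-refl)) ⟨
      ((arr n ∘ uₙ †) ∘ φ) ∘ uₘ     ≈⟨ assoc ⟩
      (arr n ∘ uₙ †) ∘ (φ ∘ uₘ)     ≈⟨ assoc ⟩
      arr n ∘ (uₙ † ∘ (φ ∘ uₘ))     ∎)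
    where
      uₘ = comparison ⟦ m ⟧ m
      uₙ = comparison ⟦ n ⟧ n

  ⟦⟧-absorbs : ∀ {X} (m n : KSubObj X) → m ≤K n → ⟦ n ⟧ ∘ arr m ≈ arr m
  ⟦⟧-absorbs m n (θ , m≈nθ) = begin
    ⟦ n ⟧ ∘ arr m          ≈⟨ ∘-congʳ m≈nθ ⟩
    ⟦ n ⟧ ∘ (arr n ∘ θ)    ≈⟨ assoc˘ ⟩
    (⟦ n ⟧ ∘ arr n) ∘ θ    ≈⟨ ∘-congˡ (projection-fixes (arr-dagger-mono n)) ⟩
    arr n ∘ θ              ≈⟨ m≈nθ ⟨
    arr m                  ∎

  ⟦⟧-absorbs-⟦⟧ : ∀ {X} (m n : KSubObj X) → m ≤K n → ⟦ n ⟧ ∘ ⟦ m ⟧ ≈ ⟦ m ⟧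
  ⟦⟧-absorbs-⟦⟧ m n m≤n = ≈-trans assoc˘ (∘-congˡ (⟦⟧-absorbs m n m≤n))

  ≤K-refl : ∀ {X} (m : KSubObj X) → m ≤K m
  ≤K-refl m = id , ≈-sym identityʳ

  ⟦⟧-idempotent : ∀ {X} (m : KSubObj X) → ⟦ m ⟧ ∘ ⟦ m ⟧ ≈ ⟦ m ⟧
  ⟦⟧-idempotent m = ⟦⟧-absorbs-⟦⟧ m m (≤K-refl m)

  -- ⟦_⟧ is constant on isomorphic subobjects: ⟦ m ⟧ ≈ ⟦ n ⟧ ∘ ⟦ m ⟧, whose
  -- dagger ⟦ m ⟧ ∘ ⟦ n ⟧ is ⟦ n ⟧.
  ⟦⟧-well-defined : ∀ {X} (m n : KSubObj X) → m ≤K n → n ≤K m → ⟦ m ⟧ ≈ ⟦ n ⟧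
  ⟦⟧-well-defined m n m≤n n≤m = begin
    ⟦ m ⟧                  ≈⟨ ⟦⟧-absorbs-⟦⟧ m n m≤n ⟨
    ⟦ n ⟧ ∘ ⟦ m ⟧          ≈⟨ ∘-resp-≈ (⟦⟧-selfAdjoint n) (⟦⟧-selfAdjoint m) ⟨
    ⟦ n ⟧ † ∘ ⟦ m ⟧ †      ≈⟨ †-homomorphism ⟨
    (⟦ m ⟧ ∘ ⟦ n ⟧) †      ≈⟨ †-resp-≈ (⟦⟧-absorbs-⟦⟧ n m n≤m) ⟩
    ⟦ n ⟧ †                ≈⟨ ⟦⟧-selfAdjoint n ⟩
    ⟦ n ⟧                  ∎

  -- If ⟦ m ⟧ ≈ ⟦ n ⟧ then m ≈ ⟦ n ⟧ ∘ m factors through n.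
  ⟦⟧-injective : ∀ {X} (m n : KSubObj X) → ⟦ m ⟧ ≈ ⟦ n ⟧ → m ≤K n
  ⟦⟧-injective m n ⟦m⟧≈⟦n⟧ = (arr n † ∘ arr m) , (begin
    arr m                  ≈⟨ ⟦⟧-absorbs m m (≤K-refl m) ⟨
    ⟦ m ⟧ ∘ arr m          ≈⟨ ∘-congˡ ⟦m⟧≈⟦n⟧ ⟩
    ⟦ n ⟧ ∘ arr m          ≈⟨ assoc ⟩
    arr n ∘ (arr n † ∘ arr m) ∎)

  -- Through the witnesses, i p ∘ m_p factors as i id ∘ m_id ∘ ψ, and
  -- i id ∘ m_id ∘ ψ ≈ i (p †) by the coimage square.
  below-id⇒⟦⟧ : ∀ {X} (p : X ⇒ X) → p ≤h id → ⟦ image (p †) ⟧ ≈ p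
  below-id⇒⟦⟧ p (mₚ , m-id , (coimage-p , _) , (_ , image-id) , φ , ψ ,
                 coimage-square , mediator-square , _ , image-square) = begin
    i (p †) ∘ i (p †) †                ≈⟨ ∘-congˡ i-id∘ψ ⟨
    (i (id †) ∘ ψ) ∘ i (p †) †         ≈⟨ ∘-congˡ (∘-congˡ i-id∘m-id) ⟨
    ((i id ∘ m-id) ∘ ψ) ∘ i (p †) †    ≈⟨ ∘-congˡ assoc ⟩
    (i id ∘ (m-id ∘ ψ)) ∘ i (p †) †    ≈⟨ ∘-congˡ (∘-congʳ mediator-square) ⟨
    (i id ∘ (φ ∘ mₚ)) ∘ i (p †) †      ≈⟨ ∘-congˡ assoc˘ ⟩
    ((i id ∘ φ) ∘ mₚ) ∘ i (p †) †      ≈⟨ ∘-congˡ (∘-congˡ image-square) ⟩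
    (i p ∘ mₚ) ∘ i (p †) †             ≈⟨ assoc ⟩
    i p ∘ (mₚ ∘ i (p †) †)             ≈⟨ ∘-congʳ coimage-p ⟩
    i p ∘ e′ p                         ≈⟨ image-factorisation p ⟩
    p                                  ∎
    where
      i-id∘ψ : i (id †) ∘ ψ ≈ i (p †)
      i-id∘ψ = ≈-trans (∘-congˡ (≈-sym †-involutive))
                 (≈-trans (≈-sym †-swapˡ) (≈-trans (†-resp-≈ coimage-square) †-involutive))
      i-id∘m-id : i id ∘ m-id ≈ i (id †)
      i-id∘m-id = ≈-trans image-id (≈-trans †-swapˡ (≈-trans (∘-congˡ †-involutive) identityˡ))

  -- If e′ p is epic, an idempotent p fixes its image: both p ∘ i p and i p
  -- give p when composed with e′ p.
  idempotent-fixes-image : ∀ {X} {p : X ⇒ X} → IsEpi (e′ p) → p ∘ p ≈ p → p ∘ i p ≈ i p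
  idempotent-fixes-image {p = p} e′-epi pp≈p = e′-epi (p ∘ i p) (i p) (begin
    (p ∘ i p) ∘ e′ p       ≈⟨ assoc ⟩
    p ∘ (i p ∘ e′ p)       ≈⟨ ∘-congʳ (image-factorisation p) ⟩
    p ∘ p                  ≈⟨ pp≈p ⟩
    p                      ≈⟨ image-factorisation p ⟨
    i p ∘ e′ p             ∎)

  selfAdjoint-fixing-image : ∀ {X} {p : X ⇒ X} → p † ≈ p → p ∘ i p ≈ i p → ⟦ image p ⟧ ≈ p
  selfAdjoint-fixing-image {p = p} p†≈p p∘ip≈ip = begin
    i p ∘ i p †            ≈⟨ projection-selfAdjoint (i p) ⟨
    (i p ∘ i p †) †        ≈⟨ †-resp-≈ (∘-congˡ p∘ip≈ip) ⟨
    ((p ∘ i p) ∘ i p †) †  ≈⟨ †-resp-≈ assoc ⟩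
    (p ∘ (i p ∘ i p †)) †  ≈⟨ †-homomorphism ⟩
    (i p ∘ i p †) † ∘ p †  ≈⟨ ∘-resp-≈ (projection-selfAdjoint (i p)) p†≈p ⟩
    (i p ∘ i p †) ∘ p      ≈⟨ assoc ⟩
    i p ∘ e′ p             ≈⟨ image-factorisation p ⟩
    p                      ∎

  projection-below-id : (∀ {A B : Obj} (f : A ⇒ B) → IsZeroEpi f → IsEpi f) →
                        ∀ {X} (p : X ⇒ X) → Proj p → ProjBelowId p
  projection-below-id zeroEpi⇒epi p (lift (p†≈p , pp≈p)) =
    p†≈p , pp≈p , ⟦⟧-monotone-at (image p) top (i p , ≈-sym identityˡ) (≈-sym p≈⟦ip⟧) ⟦top⟧
    where
      p≈⟦ip⟧ : ⟦ image p ⟧ ≈ p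
      p≈⟦ip⟧ = selfAdjoint-fixing-image p†≈p
        (idempotent-fixes-image (zeroEpi⇒epi (e′ p) (e′-zeroEpi p)) pp≈p)

  ⟦⟧-orderIso : ∀ {X} (P : X ⇒ X → Set (ℓ ⊔ e)) → (∀ m → P ⟦ m ⟧) →
                (∀ p → P p → p ≤h id) → IsOrderIsoOnto {X} P
  ⟦⟧-orderIso P lands-in below-id = record
    { lands-in     = lands-in
    ; well-defined = ⟦⟧-well-defined
    ; injective    = λ m n ⟦m⟧≈⟦n⟧ → ⟦⟧-injective m n ⟦m⟧≈⟦n⟧ , ⟦⟧-injective n m (≈-sym ⟦m⟧≈⟦n⟧)
    ; monotone     = ⟦⟧-monotone
    ; reflecting   = ⟦⟧-reflecting
    ; surjective   = λ p Pp → image (p †) , below-id⇒⟦⟧ p (below-id p Pp) }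

proposition7p5 : ∀ {o ℓ e : Level} (D : DaggerKernelCategory o ℓ e) →
    let open DaggerKernelCategory D in
    ∀ (X : Obj) →
      IsOrderIsoOnto {X} SelfAdjBelowId
      × IsOrderIsoOnto {X} ProjBelowId
      × ((∀ {A B : Obj} (f : A ⇒ B) → IsZeroEpi f → IsEpi f) →
           (∀ (p : X ⇒ X) → ProjBelowId p ⇔ Proj p)
           × IsOrderIsoOnto {X} Proj)
proposition7p5 D X =
    ⟦⟧-orderIso SelfAdjBelowId (λ m → ⟦⟧-selfAdjoint m , ⟦⟧-below-id m) (λ _ → proj₂)
  , ⟦⟧-orderIso ProjBelowId projection-of-kernel (λ _ → proj₂ ∘′ proj₂)
  , λ zeroEpi⇒epi →
      (λ p → mk⇔ (λ (p†≈p , pp≈p , _) → lift (p†≈p , pp≈p)) (projection-below-id zeroEpi⇒epi p))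
    , ⟦⟧-orderIso Proj (λ m → lift (⟦⟧-selfAdjoint m , ⟦⟧-idempotent m))
        (λ p Pp → proj₂ (proj₂ (projection-below-id zeroEpi⇒epi p Pp)))
  where
    open DaggerKernelCategory D
    open Projections D
    projection-of-kernel : ∀ m → ProjBelowId ⟦ m ⟧
    projection-of-kernel m = ⟦⟧-selfAdjoint m , ⟦⟧-idempotent m , ⟦⟧-below-id m
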